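{- Let $B(\lambda)$ be the crystal poset of the irreducible integrable highest weight module $V(\lambda)$ of a symmetrizable Kac–Moody algebra, with key map $\kappa:B(\lambda)\to W$. If $u,u'\in B(\lambda)$ are both covered by $v$ and $\kappa(u)=\kappa(u')$, then $\kappa(v)=\kappa(u)=\kappa(u')$.
   Context: Let $\mathfrak g$ be a symmetrizable Kac–Moody algebra with simple roots $\alpha_i$ ($i\in I$), Weyl group $W$ generated by simple reflections $s_i$, length function $\ell$. For a dominant weight $\lambda$, $B(\lambda)$ is Kashiwara's crystal of $V(\lambda)$, with crystal operators $e_i,f_i:B(\lambda)\to B(\lambda)\cup\{\mathbf 0\}$ ($f_i(b)=b'$ iff $e_i(b')=b$). The crystal poset on $B(\lambda)$ is the partial order generated by the cover relations $b\lessdot f_i(b)$ (whenever $f_i(b)\ne\mathbf 0$), colored $i$; it has a minimum $\hat 0$. For $w\in W$ let $B_w(\lambda)$ be the Demazure subcrystal; the (right) key $\kappa(b)$ is the minimal $w$ in Bruhat order, among lowest coset representatives modulo the stabilizer $W_\lambda$ of $\lambda$, with $b\in B_w(\lambda)$. Standard facts: $\kappa(\hat 0)=1$; if $f_p(b)\ne\mathbf 0$ then $\kappa(f_p(b))=\kappa(b)$ when $e_p(b)\ne\mathbf 0$ and $\kappa(f_p(b))\in\{s_p\kappa(b),\kappa(b)\}$ when $e_p(b)=\mathbf 0$; if $e_p(b)=\mathbf 0$ then $\ell(s_p\kappa(b))>\ell(\kappa(b))$. -}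

module Defs where

open import Level using (0ℓ)
open import Relation.Nullary using (¬_)
open import Data.Nat using (ℕ; _>_)
open import Data.Maybe using (Maybe; just; nothing)
open import Data.Product using (∃; _×_)
open import Data.Sum using (_⊎_)
open import Algebra.Bundles using (Group)
open import Relation.Binary.PropositionalEquality using (_≡_; _≢_)
open import Relation.Binary.Construct.Closure.ReflexiveTransitive using (Star)

-- Axiomatic interface for the data (B(λ), e_i, f_i, κ, W, s_i, ℓ) of the
-- paper.
record KeyedCrystal : Set₁ where
  field
    I : Set
    W : Group 0ℓ 0ℓ
  open Group W public using (Carrier; _≈_; _∙_; ε)
  field
    s : I → Carrier
    s-invol : ∀ i → (s i ∙ s i) ≈ ε
    s-distinct : ∀ i j → i ≢ j → ¬ (s i ≈ s j)
    len : Carrier → ℕ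
    len-cong : ∀ {x y} → x ≈ y → len x ≡ len y
    B : Set
    e f : I → B → Maybe B
    f⇔e : ∀ i b b' → (f i b ≡ just b' → e i b' ≡ just b)
                   × (e i b' ≡ just b → f i b ≡ just b')
    0̂ : B
    0̂-min : ∀ b → Star (λ x y → ∃ λ i → f i x ≡ just y) 0̂ b
    κ : B → Carrier
    κ-0̂ : κ 0̂ ≈ ε
    κ-f-e≠0 : ∀ p b b' b'' → f p b ≡ just b' → e p b ≡ just b'' → κ b' ≈ κ b
    κ-f-e=0 : ∀ p b b' → f p b ≡ just b' → e p b ≡ nothing
              → (κ b' ≈ (s p ∙ κ b)) ⊎ (κ b' ≈ κ b)
    κ-len : ∀ p b → e p b ≡ nothing → len (s p ∙ κ b) > len (κ b)
  Covers : B → B → Set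
  Covers u v = ∃ λ i → f i u ≡ just v

-- A cover v of u along colour i has κ v ∈ {κ u, s_i κ u}. If neither of two
-- distinct lower covers u, u' of v had κ v equal to its key, then
-- s_i κ u = κ v = s_j κ u' with κ u = κ u', so s_i = s_j; but injectivity of
-- f_i forces i ≠ j, and distinct colours have distinct reflections.
module Submission where

open import Defs
open import Algebra.Bundles using (Group)
import Algebra.Properties.Group as GroupProperties
open import Data.Product using (_×_; _,_; proj₁)
open import Data.Sum using (_⊎_; inj₁; inj₂)
open import Data.Maybe using (Maybe; just; nothing)
open import Relation.Nullary using (contradiction)
open import Relation.Binary.PropositionalEquality
  using (_≡_; _≢_; refl; trans; sym)

module KeyedCrystalProperties (K : KeyedCrystal) where

  open KeyedCrystal K
  open Group W using (∙-congˡ) renaming (sym to ≈-sym; trans to ≈-trans)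
  open GroupProperties W using (∙-cancelʳ)

  f-injective : ∀ i {u u' v} → f i u ≡ just v → f i u' ≡ just v → u ≡ u'
  f-injective i {u} {u'} {v} fu fu'
    with trans (sym (proj₁ (f⇔e i u v) fu)) (proj₁ (f⇔e i u' v) fu')
  ... | refl = refl

  colours-distinct : ∀ {i j u u' v} → u ≢ u' →
                     f i u ≡ just v → f j u' ≡ just v → i ≢ j
  colours-distinct u≢u' fu fu' refl = u≢u' (f-injective _ fu fu')

  κ-f : ∀ i {u v} → f i u ≡ just v → (κ v ≈ κ u) ⊎ (κ v ≈ (s i ∙ κ u))
  κ-f i {u} {v} fu = by-e (e i u) refl
    where
    by-e : (x : Maybe B) → e i u ≡ x → (κ v ≈ κ u) ⊎ (κ v ≈ (s i ∙ κ u))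
    by-e (just b) eu = inj₁ (κ-f-e≠0 i u v b fu eu)
    by-e nothing  eu with κ-f-e=0 i u v fu eu
    ... | inj₁ reflected = inj₂ reflected
    ... | inj₂ fixed     = inj₁ fixed

  s-injective-on-equal-keys : ∀ {i j x y} → x ≈ y →
                              (s i ∙ x) ≈ (s j ∙ y) → s i ≈ s j
  s-injective-on-equal-keys {i} {j} {x} x≈y eq =
    ∙-cancelʳ x (s i) (s j) (≈-trans eq (∙-congˡ (≈-sym x≈y)))

  κ-common-cover : ∀ {u u' v} → u ≢ u' → Covers u v → Covers u' v →
                   κ u ≈ κ u' → (κ v ≈ κ u) × (κ v ≈ κ u')
  κ-common-cover u≢u' (i , fu) (j , fu') κu≈κu' with κ-f i fu | κ-f j fu'
  ... | inj₁ κv≈κu   | _            = κv≈κu , ≈-trans κv≈κu κu≈κu'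
  ... | inj₂ _       | inj₁ κv≈κu'  = ≈-trans κv≈κu' (≈-sym κu≈κu') , κv≈κu'
  ... | inj₂ κv≈siκu | inj₂ κv≈sjκu' =
    contradiction
      (s-injective-on-equal-keys κu≈κu' (≈-trans (≈-sym κv≈siκu) κv≈sjκu'))
      (s-distinct i j (colours-distinct u≢u' fu fu'))

lemma3p2 : (K : KeyedCrystal) → let open KeyedCrystal K in
    ∀ (u u' v : B) → u ≢ u' → Covers u v → Covers u' v → κ u ≈ κ u'
    → (κ v ≈ κ u) × (κ v ≈ κ u')
lemma3p2 K u u' v = KeyedCrystalProperties.κ-common-cover K
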